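{- For integers $n\ge 3$ and $2\le r\le n+1$, $\kappa(FQ_n;K_{1,r})\le\lceil \frac{n+1}{2}\rceil$ and $\kappa^s(FQ_n;K_{1,r})\le\lceil \frac{n+1}{2}\rceil$.
   Context: The $n$-dimensional hypercube $Q_n$ has as vertices all binary strings of length $n$, two strings being adjacent iff they differ in exactly one position. The folded hypercube $FQ_n$ is obtained from $Q_n$ by adding, for every vertex $u=u_1\cdots u_n$, the edge between $u$ and its complement $\bar u=\bar u_1\cdots\bar u_n$ (where $\bar u_i=1-u_i$). $K_{1,r}$ denotes the star with $r$ leaves. For a graph $G$ and a set $F$ of subgraphs of $G$, $G-F$ denotes the graph obtained from $G$ by deleting all vertices of all members of $F$. For a connected graph $T$, $\kappa(G;T)$ is the minimum cardinality of a set $F$ of subgraphs of $G$, each isomorphic to $T$, such that $G-F$ is disconnected; $\kappa^s(G;T)$ is the minimum cardinality of a set $F$ of subgraphs of $G$, each isomorphic to a connected subgraph of $T$, such that $G-F$ is disconnected. -}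

module Defs where

open import Data.Nat using (ℕ; _≤_)
open import Data.Bool using (Bool; not)
open import Data.Fin using (Fin)
open import Data.Vec using (Vec; lookup; map)
open import Data.Product using (Σ; ∃; _×_; _,_)
open import Data.Sum using (_⊎_)
open import Data.List using (List; length)
open import Data.List.Relation.Unary.Any using (Any)
open import Function.Definitions using (Injective)
open import Relation.Nullary using (¬_)
open import Relation.Binary.PropositionalEquality using (_≡_; _≢_)

Vertex : ℕ → Set
Vertex n = Vec Bool n

HypercubeAdj : {n : ℕ} → Vertex n → Vertex n → Set
HypercubeAdj {n} u v =
  Σ (Fin n) λ i → (lookup u i ≢ lookup v i) × (∀ j → j ≢ i → lookup u j ≡ lookup v j)

complement : {n : ℕ} → Vertex n → Vertex n
complement u = map not u

FQAdj : {n : ℕ} → Vertex n → Vertex n → Set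
FQAdj u v = HypercubeAdj u v ⊎ (v ≡ complement u) ⊎ (u ≡ complement v)

-- A subgraph of FQ_n isomorphic to the star K_{1,s}: a centre together with
-- s pairwise distinct leaves, each adjacent (in FQ_n) to the centre.
-- (s = 0 gives K_1, a single vertex.)
record Star (n s : ℕ) : Set where
  field
    center : Vertex n
    leaf   : Fin s → Vertex n
    leaf-injective : Injective _≡_ _≡_ leaf
    leaf-adj : ∀ i → FQAdj center (leaf i)
open Star public

InStar : {n s : ℕ} → Vertex n → Star n s → Set
InStar x S = (x ≡ center S) ⊎ (Σ (Fin _) λ i → leaf S i ≡ x)

-- A subgraph isomorphic to a connected subgraph of K_{1,r}: a star K_{1,s} with s ≤ r
record SubStar (n r : ℕ) : Set where
  field
    size  : ℕ
    size≤ : size ≤ r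
    star  : Star n size
open SubStar public

DeletedBy : {n r : ℕ} → Vertex n → List (Star n r) → Set
DeletedBy x F = Any (InStar x) F

DeletedByˢ : {n r : ℕ} → Vertex n → List (SubStar n r) → Set
DeletedByˢ x F = Any (λ S → InStar x (star S)) F

data Reach {n : ℕ} (Alive : Vertex n → Set) : Vertex n → Vertex n → Set where
  here : ∀ {u} → Alive u → Reach Alive u u
  step : ∀ {u w v} → Alive u → FQAdj u w → Reach Alive w v → Reach Alive u v

Disconnected : {n : ℕ} → (Vertex n → Set) → Set
Disconnected {n} Alive =
  Σ (Vertex n) λ u → Σ (Vertex n) λ v → Alive u × Alive v × ¬ Reach Alive u v

FQ-minus-Disconnected : {n r : ℕ} → List (Star n r) → Set
FQ-minus-Disconnected {n} F = Disconnected {n} (λ x → ¬ DeletedBy x F)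

FQ-minus-Disconnectedˢ : {n r : ℕ} → List (SubStar n r) → Set
FQ-minus-Disconnectedˢ {n} F = Disconnected {n} (λ x → ¬ DeletedByˢ x F)

κ-FQ-star-≤ : ℕ → ℕ → ℕ → Set
κ-FQ-star-≤ n r k = Σ (List (Star n r)) λ F → (length F ≤ k) × FQ-minus-Disconnected F

κˢ-FQ-star-≤ : ℕ → ℕ → ℕ → Set
κˢ-FQ-star-≤ n r k = Σ (List (SubStar n r)) λ F → (length F ≤ k) × FQ-minus-Disconnectedˢ F

-- A vertex of FQ_n is a subset of the n + 1 coordinates {0, …, n} taken up to
-- complement, its neighbours being the sets obtained by toggling one
-- coordinate. Pair the coordinates as {0,1}, {2,3}, …, closing with {n,0}
-- when n is even; this uses ⌈(n+1)/2⌉ pairs, and the star centred at the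
-- pair {a,b} has the singletons {a} and {b} among its leaves. So the stars
-- swallow every neighbour of the empty set u, while u and v = {0,2} survive:
-- every star vertex is a pair {a,b} or {a,b} with one coordinate toggled, and
-- comparing it with {0,2} leaves a symmetric difference that is neither empty
-- nor everything. Thus u is isolated from v. Reading each K_{1,r} as a
-- connected subgraph of itself gives the bound for κˢ.
module Submission where

open import Defs
open import Data.Bool using (Bool; true; false; not; _xor_; if_then_else_)
open import Data.Bool.Properties
  using (xor-assoc; xor-comm; xor-identityʳ; not-distribʳ-xor; not-involutive; ¬-not; not-¬; xor-∧-commutativeRing)
open import Data.Empty using (⊥-elim)
open import Data.Fin as Fin using (Fin; toℕ; fromℕ<)
open import Data.Fin.Properties using (toℕ<n; toℕ-fromℕ<; toℕ-injective)
open import Data.List as List using (List; []; _∷_; _++_; length; foldr; filter)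
open import Data.List.Membership.Propositional using (_∉_)
open import Data.List.Membership.Propositional.Properties using (∈-filter⁺)
open import Data.Nat using (ℕ; zero; suc; _+_; _≤_; _<_; _≟_; _≤?_; z≤n; s≤s; ⌊_/2⌋; ⌈_/2⌉)
open import Data.List.Membership.DecPropositional _≟_ using (_∈?_)
open import Data.List.Properties using (filter-notAll; length-map; length-tabulate)
open import Data.List.Relation.Unary.All using (_∷_; [])
open import Data.List.Relation.Unary.All.Properties using (All¬⇒¬Any)
open import Data.List.Relation.Unary.Any as Any using (Any; here; there)
open import Data.List.Relation.Unary.Any.Properties using (map⁺; map⁻; tabulate⁺; tabulate⁻)
open import Data.Maybe using (just; nothing)
open import Data.Nat.Properties
open import Data.Product using (Σ; ∃; _×_; _,_)
open import Data.Sum using (_⊎_; inj₁; inj₂; [_,_]′)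
open import Data.Vec using (Vec; lookup; tabulate)
open import Data.Vec.Properties
  using (lookup∘tabulate; tabulate∘lookup; tabulate-cong; tabulate-∘; map-∘; map-cong; map-id)
open import Function using (_∘_)
open import Relation.Nullary using (¬_; yes; no; does; ¬?)
open import Relation.Nullary.Decidable using (dec-true; dec-false)
open import Relation.Binary.PropositionalEquality
open import Tactic.RingSolver using (solve-∀)
open import Tactic.RingSolver.Core.AlmostCommutativeRing
  using (AlmostCommutativeRing; fromCommutativeRing)

-- Its coefficients are Booleans themselves, so the solver knows x xor x ≡ false.
xorRing : AlmostCommutativeRing _ _
xorRing = fromCommutativeRing xor-∧-commutativeRing λ { false → just refl ; true → nothing }

xor-cancel-outer : ∀ e a b → e xor (a xor (e xor b)) ≡ a xor b
xor-cancel-outer = solve-∀ xorRing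

xor-cancelʳ : ∀ a b c → (a xor c) xor (b xor c) ≡ a xor b
xor-cancelʳ = solve-∀ xorRing

xor-cancelˡ : ∀ a b c → (a xor b) xor (a xor c) ≡ b xor c
xor-cancelˡ = solve-∀ xorRing

xor-transpose : ∀ a b c d → a xor c ≡ b xor d → a xor b ≡ c xor d
xor-transpose a b c d e = begin
  a xor b                  ≡⟨ xor-cancelʳ a b c ⟨
  (a xor c) xor (b xor c)  ≡⟨ cong (_xor (b xor c)) e ⟩
  (b xor d) xor (b xor c)  ≡⟨ xor-cancelˡ b d c ⟩
  d xor c                  ≡⟨ xor-comm d c ⟩
  c xor d                  ∎
  where open ≡-Reasoning

swap : ℕ → ℕ → ℕ → ℕ
swap x y z = if does (z ≟ x) then y else if does (z ≟ y) then x else z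

swap-matchˡ : ∀ x y → swap x y x ≡ y
swap-matchˡ x y rewrite dec-true (x ≟ x) refl = refl

swap-matchʳ : ∀ x y → swap x y y ≡ x
swap-matchʳ x y with y ≟ x
... | yes y≡x rewrite dec-true (y ≟ x) y≡x = y≡x
... | no y≢x rewrite dec-false (y ≟ x) y≢x | dec-true (y ≟ y) refl = refl

swap-other : ∀ {x y z} → z ≢ x → z ≢ y → swap x y z ≡ z
swap-other {x} {y} {z} z≢x z≢y rewrite dec-false (z ≟ x) z≢x | dec-false (z ≟ y) z≢y = refl

swap-involutive : ∀ x y z → swap x y (swap x y z) ≡ z
swap-involutive x y z with z ≟ x | z ≟ y
... | yes refl | _        = trans (cong (swap z y) (swap-matchˡ z y)) (swap-matchʳ z y)
... | no _     | yes refl = trans (cong (swap x z) (swap-matchʳ x z)) (swap-matchˡ x z)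
... | no z≢x   | no z≢y   = trans (cong (swap x y) (swap-other z≢x z≢y)) (swap-other z≢x z≢y)

swap-injective : ∀ x y {z z'} → swap x y z ≡ swap x y z' → z ≡ z'
swap-injective x y {z} {z'} e =
  trans (sym (swap-involutive x y z)) (trans (cong (swap x y) e) (swap-involutive x y z'))

swap-≤ : ∀ {n x y z} → x ≤ n → y ≤ n → z ≤ n → swap x y z ≤ n
swap-≤ {x = x} {y} {z} x≤ y≤ z≤ with z ≟ x | z ≟ y
... | yes refl | _        rewrite swap-matchˡ z y = y≤
... | no _     | yes refl rewrite swap-matchʳ x z = x≤
... | no z≢x   | no z≢y   rewrite swap-other z≢x z≢y = z≤

k≤⌊n/2⌋⇒k+k≤n : ∀ {k} n → k ≤ ⌊ n /2⌋ → k + k ≤ n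
k≤⌊n/2⌋⇒k+k≤n n k≤⌊n/2⌋ = ≤-trans (+-mono-≤ k≤⌊n/2⌋ (≤-trans k≤⌊n/2⌋ (⌊n/2⌋≤⌈n/2⌉ n)))
                                  (≤-reflexive (⌊n/2⌋+⌈n/2⌉≡n n))

even-or-odd : ∀ t → t ≡ ⌊ t /2⌋ + ⌊ t /2⌋ ⊎ t ≡ suc (⌊ t /2⌋ + ⌊ t /2⌋)
even-or-odd zero          = inj₁ refl
even-or-odd (suc zero)    = inj₂ refl
even-or-odd (suc (suc t)) with even-or-odd t
... | inj₁ even = inj₁ (cong suc (trans (cong suc even) (sym (+-suc ⌊ t /2⌋ ⌊ t /2⌋))))
... | inj₂ odd  = inj₂ (cong suc (trans (cong suc odd) (cong suc (sym (+-suc ⌊ t /2⌋ ⌊ t /2⌋)))))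

lookup-extensional : ∀ {A : Set} {n} {v w : Vec A n} → (∀ i → lookup v i ≡ lookup w i) → v ≡ w
lookup-extensional {v = v} {w} eq =
  trans (sym (tabulate∘lookup v)) (trans (tabulate-cong eq) (tabulate∘lookup w))

∃-∉-below : ∀ m (L : List ℕ) → length L < m → ∃ λ y → y < m × y ∉ L
∃-∉-below (suc m) L |L|<1+m with m ∈? L
... | no m∉L = m , ≤-refl , m∉L
... | yes m∈L with ∃-∉-below m (filter (λ x → ¬? (x ≟ m)) L)
                     (≤-trans (filter-notAll _ L (Any.map (λ x≡m x≢m → x≢m (sym x≡m)) m∈L))
                              (≤-pred |L|<1+m))
... | y , y<m , y∉filter =
  y , m<n⇒m<1+n y<m , λ y∈L → y∉filter (∈-filter⁺ _ y∈L (<⇒≢ y<m))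

-- Sets of coordinates

-- A set of coordinates is its indicator function ℕ → Bool; flips L is the set
-- of coordinates occurring an odd number of times in L.

_⊕_ : (ℕ → Bool) → (ℕ → Bool) → ℕ → Bool
(s ⊕ s') j = s j xor s' j

toggle : ℕ → (ℕ → Bool) → ℕ → Bool
toggle p s j = does (j ≟ p) xor s j

flips : List ℕ → ℕ → Bool
flips = foldr toggle (λ _ → false)

toggle-⊕ : ∀ p s s' → toggle p s ⊕ s' ≗ toggle p (s ⊕ s')
toggle-⊕ p s s' j = xor-assoc (does (j ≟ p)) (s j) (s' j)

flips-++ : ∀ L L' → flips (L ++ L') ≗ flips L ⊕ flips L'
flips-++ []      L' j = refl
flips-++ (x ∷ L) L' j = trans (cong (does (j ≟ x) xor_) (flips-++ L L' j))
                              (sym (xor-assoc (does (j ≟ x)) (flips L j) (flips L' j)))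

flips-cancel : ∀ L₁ x L₂ L₃ → flips (L₁ ++ x ∷ L₂ ++ x ∷ L₃) ≗ flips (L₁ ++ L₂ ++ L₃)
flips-cancel (y ∷ L₁) x L₂ L₃ j = cong (does (j ≟ y) xor_) (flips-cancel L₁ x L₂ L₃ j)
flips-cancel []       x L₂ L₃ j = begin
  does (j ≟ x) xor flips (L₂ ++ x ∷ L₃) j
    ≡⟨ cong (does (j ≟ x) xor_) (flips-++ L₂ (x ∷ L₃) j) ⟩
  does (j ≟ x) xor (flips L₂ j xor (does (j ≟ x) xor flips L₃ j))
    ≡⟨ xor-cancel-outer (does (j ≟ x)) (flips L₂ j) (flips L₃ j) ⟩
  flips L₂ j xor flips L₃ j
    ≡⟨ flips-++ L₂ L₃ j ⟨
  flips (L₂ ++ L₃) j ∎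
  where open ≡-Reasoning

flips-∉ : ∀ {y L} → y ∉ L → flips L y ≡ false
flips-∉ {L = []}    _   = refl
flips-∉ {y} {x ∷ L} y∉L
  rewrite dec-false (y ≟ x) (y∉L ∘ here) | flips-∉ (y∉L ∘ there) = refl

flips-once : ∀ L₁ x L₂ → x ∉ L₁ → x ∉ L₂ → flips (L₁ ++ x ∷ L₂) x ≡ true
flips-once []       x L₂ _     x∉L₂ rewrite dec-true (x ≟ x) refl | flips-∉ x∉L₂ = refl
flips-once (y ∷ L₁) x L₂ x∉yL₁ x∉L₂
  rewrite dec-false (x ≟ y) (x∉yL₁ ∘ here) = flips-once L₁ x L₂ (x∉yL₁ ∘ there) x∉L₂

-- Vertices of the folded hypercube

module _ {n : ℕ} where

  -- Coordinate n is the folding direction: toggling it complements the string.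
  vertex : (ℕ → Bool) → Vertex n
  vertex s = tabulate λ i → s (toℕ i) xor s n

  lookup-vertex : ∀ s i → lookup (vertex s) i ≡ s (toℕ i) xor s n
  lookup-vertex s = lookup∘tabulate _

  vertex-cong : ∀ {s s'} → s ≗ s' → vertex s ≡ vertex s'
  vertex-cong s≗s' = tabulate-cong λ i → cong₂ _xor_ (s≗s' (toℕ i)) (s≗s' n)

  complement-involutive : ∀ (w : Vertex n) → complement (complement w) ≡ w
  complement-involutive w =
    trans (sym (map-∘ not not w)) (trans (map-cong not-involutive w) (map-id w))

  lookup-vertex-toggle : ∀ {p} s i → p < n →
    lookup (vertex (toggle p s)) i ≡ does (toℕ i ≟ p) xor lookup (vertex s) i
  lookup-vertex-toggle {p} s i p<n
    rewrite lookup-vertex (toggle p s) i | lookup-vertex s i | dec-false (n ≟ p) (<⇒≢ p<n ∘ sym)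
    = xor-assoc (does (toℕ i ≟ p)) (s (toℕ i)) (s n)

  vertex-toggle-fold : ∀ s → vertex (toggle n s) ≡ complement (vertex s)
  vertex-toggle-fold s = trans (tabulate-cong toggled) (tabulate-∘ not _)
    where
    toggled : ∀ i → toggle n s (toℕ i) xor toggle n s n ≡ not (s (toℕ i) xor s n)
    toggled i rewrite dec-false (toℕ i ≟ n) (<⇒≢ (toℕ<n i)) | dec-true (n ≟ n) refl
      = sym (not-distribʳ-xor (s (toℕ i)) (s n))

  toggle-adjacent : ∀ {p} s → p ≤ n → FQAdj (vertex s) (vertex (toggle p s))
  toggle-adjacent {p} s p≤n with m≤n⇒m<n∨m≡n p≤n
  ... | inj₂ refl = inj₂ (inj₁ (vertex-toggle-fold s))
  ... | inj₁ p<n  = inj₁ (i , differ , agree)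
    where
    i = fromℕ< p<n
    differ : lookup (vertex s) i ≢ lookup (vertex (toggle p s)) i
    differ rewrite lookup-vertex-toggle s i p<n | toℕ-fromℕ< p<n | dec-true (p ≟ p) refl
      = not-¬ refl
    agree : ∀ j → j ≢ i → lookup (vertex s) j ≡ lookup (vertex (toggle p s)) j
    agree j j≢i rewrite lookup-vertex-toggle s j p<n
      | dec-false (toℕ j ≟ p) (λ e → j≢i (toℕ-injective (trans e (sym (toℕ-fromℕ< p<n)))))
      = refl

  adjacent⇒toggle : ∀ {s w} → FQAdj (vertex s) w → ∃ λ p → p ≤ n × w ≡ vertex (toggle p s)
  adjacent⇒toggle {s} {w} (inj₁ (i , differ , agree)) =
    toℕ i , <⇒≤ (toℕ<n i) , lookup-extensional entry
    where
    entry : ∀ j → lookup w j ≡ lookup (vertex (toggle (toℕ i) s)) j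
    entry j rewrite lookup-vertex-toggle s j (toℕ<n i) with j Fin.≟ i
    ... | yes refl rewrite dec-true (toℕ j ≟ toℕ j) refl = ¬-not (differ ∘ sym)
    ... | no j≢i rewrite dec-false (toℕ j ≟ toℕ i) (j≢i ∘ toℕ-injective) = sym (agree j j≢i)
  adjacent⇒toggle {s} (inj₂ (inj₁ refl)) = n , ≤-refl , sym (vertex-toggle-fold s)
  adjacent⇒toggle {s} {w} (inj₂ (inj₂ e)) = n , ≤-refl , (begin
    w                          ≡⟨ complement-involutive w ⟨
    complement (complement w)  ≡⟨ cong complement e ⟨
    complement (vertex s)      ≡⟨ vertex-toggle-fold s ⟨
    vertex (toggle n s)        ∎)
    where open ≡-Reasoning

  NonConstant : (ℕ → Bool) → Set
  NonConstant d = Σ ℕ λ x → Σ ℕ λ y → x ≤ n × y ≤ n × d x ≢ d y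

  NonConstant-resp : ∀ {d d'} → d ≗ d' → NonConstant d → NonConstant d'
  NonConstant-resp d≗d' (x , y , x≤n , y≤n , dx≢dy) =
    x , y , x≤n , y≤n , λ e → dx≢dy (trans (d≗d' x) (trans e (sym (d≗d' y))))

  vertex-≡⇒⊕-constant : ∀ {s s' x} → vertex s ≡ vertex s' → x ≤ n → (s ⊕ s') x ≡ (s ⊕ s') n
  vertex-≡⇒⊕-constant {s} {s'} e x≤n with m≤n⇒m<n∨m≡n x≤n
  ... | inj₂ refl = refl
  ... | inj₁ x<n  = subst (λ y → (s ⊕ s') y ≡ (s ⊕ s') n) (toℕ-fromℕ< x<n)
                      (xor-transpose (s (toℕ i)) (s' (toℕ i)) (s n) (s' n) (begin
                        s (toℕ i) xor s n     ≡⟨ lookup-vertex s i ⟨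
                        lookup (vertex s) i   ≡⟨ cong (λ w → lookup w i) e ⟩
                        lookup (vertex s') i  ≡⟨ lookup-vertex s' i ⟩
                        s' (toℕ i) xor s' n   ∎))
    where
    open ≡-Reasoning
    i = fromℕ< x<n

  vertex-≢ : ∀ {s s'} → NonConstant (s ⊕ s') → vertex s ≢ vertex s'
  vertex-≢ {s} {s'} (x , y , x≤n , y≤n , dx≢dy) e = dx≢dy (trans
    (vertex-≡⇒⊕-constant {s} {s'} e x≤n) (sym (vertex-≡⇒⊕-constant {s} {s'} e y≤n)))

  odd⇒NonConstant : ∀ {x} L → x ≤ n → flips L x ≡ true → length L ≤ n → NonConstant (flips L)
  odd⇒NonConstant {x} L x≤n odd |L|≤n with ∃-∉-below (suc n) L (s≤s |L|≤n)
  ... | y , y<1+n , y∉L = x , y , x≤n , ≤-pred y<1+n , λ e → not-¬ odd (trans e (flips-∉ y∉L))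

  flips-pair-NonConstant : ∀ {p q} → p ≤ n → p ≢ q → 2 ≤ n → NonConstant (flips (p ∷ q ∷ []))
  flips-pair-NonConstant {p} {q} p≤n p≢q =
    odd⇒NonConstant (p ∷ q ∷ []) p≤n (flips-once [] p (q ∷ []) (λ ()) (All¬⇒¬Any (p≢q ∷ [])))

  toggle-injective : ∀ {p q} s → 2 ≤ n → p ≤ n → q ≤ n →
                     vertex (toggle p s) ≡ vertex (toggle q s) → p ≡ q
  toggle-injective {p} {q} s 2≤n p≤n q≤n e with p ≟ q
  ... | yes p≡q = p≡q
  ... | no p≢q  = ⊥-elim (vertex-≢ {toggle p s} {toggle q s} difference e)
    where
    difference : NonConstant (toggle p s ⊕ toggle q s)
    difference = NonConstant-resp
      (λ j → trans (cong (does (j ≟ p) xor_) (xor-identityʳ (does (j ≟ q))))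
                   (sym (xor-cancelʳ (does (j ≟ p)) (does (j ≟ q)) (s j))))
      (flips-pair-NonConstant p≤n p≢q 2≤n)

  -- vertex s is at distance at least 2 from vertex c.
  FarFrom : (ℕ → Bool) → (ℕ → Bool) → Set
  FarFrom c s = NonConstant (c ⊕ s) × (∀ t → t ≤ n → NonConstant (toggle t c ⊕ s))

  -- After toggling any t, one of p, q still occurs once, and the list is too
  -- short to cover all n + 1 coordinates, so some coordinate occurs zero times.
  far-by-parity : ∀ {c s} p q L → c ⊕ s ≗ flips (p ∷ q ∷ L) →
    p ≤ n → q ≤ n → p ≢ q → p ∉ L → q ∉ L → 3 + length L ≤ n → FarFrom c s
  far-by-parity {c} {s} p q L c⊕s≗K p≤n q≤n p≢q p∉L q∉L |tK|≤n =
    NonConstant-resp (sym ∘ c⊕s≗K) (odd⇒NonConstant K p≤n odd-p (≤-trans (n≤1+n _) |tK|≤n)) ,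
    λ t _ → NonConstant-resp (λ j → sym (trans (toggle-⊕ t c s j) (cong (does (j ≟ t) xor_) (c⊕s≗K j))))
              (odd-point t)
    where
    K = p ∷ q ∷ L
    p∉qL : p ∉ q ∷ L
    p∉qL (here p≡q)  = p≢q p≡q
    p∉qL (there p∈L) = p∉L p∈L
    odd-p : flips K p ≡ true
    odd-p = flips-once [] p (q ∷ L) (λ ()) p∉qL
    odd-point : ∀ t → NonConstant (flips (t ∷ K))
    odd-point t with t ≟ p
    ... | yes refl = odd⇒NonConstant (t ∷ K) q≤n
          (flips-once (t ∷ t ∷ []) q L (All¬⇒¬Any (q≢p ∷ q≢p ∷ [])) q∉L) |tK|≤n
      where q≢p = p≢q ∘ sym
    ... | no t≢p = odd⇒NonConstant (t ∷ K) p≤n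
          (flips-once (t ∷ []) p (q ∷ L) (All¬⇒¬Any ((t≢p ∘ sym) ∷ [])) p∉qL) |tK|≤n

  far-from-origin : ∀ {a b} → a ≤ n → b ≤ n → a ≢ b → 3 ≤ n →
                    FarFrom (flips (a ∷ b ∷ [])) (flips [])
  far-from-origin a≤n b≤n a≢b 3≤n =
    far-by-parity _ _ [] (λ j → xor-identityʳ _) a≤n b≤n a≢b (λ ()) (λ ()) 3≤n

-- Disconnected subgraphs

module _ {n : ℕ} where

  Reach-alive : ∀ {A : Vertex n → Set} {u v} → Reach A u v → A u
  Reach-alive (here Au)     = Au
  Reach-alive (step Au _ _) = Au

  Reach-map : ∀ {A B : Vertex n → Set} → (∀ {x} → A x → B x) → ∀ {u v} → Reach A u v → Reach B u v
  Reach-map A⇒B (here Au)           = here (A⇒B Au)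
  Reach-map A⇒B (step Au adj reach) = step (A⇒B Au) adj (Reach-map A⇒B reach)

  Disconnected-resp : ∀ {A B : Vertex n → Set} → (∀ {x} → A x → B x) → (∀ {x} → B x → A x) → Disconnected A → Disconnected B
  Disconnected-resp A⇒B B⇒A (u , v , Au , Av , ¬reach) =
    u , v , A⇒B Au , A⇒B Av , ¬reach ∘ Reach-map B⇒A

isolated⇒Disconnected : ∀ {n} {A : Vertex n → Set} {u v} → u ≢ v → A u → A v →
                        (∀ w → FQAdj u w → ¬ A w) → Disconnected A
isolated⇒Disconnected u≢v Au Av isolated = _ , _ , Au , Av , λ
  { (here _)           → u≢v refl
  ; (step _ adj reach) → isolated _ adj (Reach-alive reach) }

κˢ≤κ : ∀ {n r k} → κ-FQ-star-≤ n r k → κˢ-FQ-star-≤ n r k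
κˢ≤κ {n} {r} (F , |F|≤k , disconnected) =
  List.map asSubStar F ,
  subst (_≤ _) (sym (length-map asSubStar F)) |F|≤k ,
  Disconnected-resp (λ notInF → notInF ∘ map⁻) (λ notInF → notInF ∘ map⁺) disconnected
  where
  asSubStar : Star n r → SubStar n r
  asSubStar S = record { size = r ; size≤ = ≤-refl ; star = S }

-- The star centred at a pair of coordinates

module PairStar {n r : ℕ} (2≤r : 2 ≤ r) (r≤1+n : r ≤ suc n) (2≤n : 2 ≤ n)
                {a b : ℕ} (a≤n : a ≤ n) (b≤n : b ≤ n) (a≢b : a ≢ b) (a≢1 : a ≢ 1) where

  centre : ℕ → Bool
  centre = flips (a ∷ b ∷ [])

  -- A permutation of ℕ preserving {0, …, n} and sending 0 ↦ a, 1 ↦ b (as a ≢ 1).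
  leafCoordinate : ℕ → ℕ
  leafCoordinate j = swap 1 b (swap 0 a j)

  leafCoordinate-≤ : ∀ (j : Fin r) → leafCoordinate (toℕ j) ≤ n
  leafCoordinate-≤ j =
    swap-≤ (≤-trans (s≤s z≤n) 2≤n) b≤n (swap-≤ z≤n a≤n (≤-pred (≤-trans (toℕ<n j) r≤1+n)))

  pairStar : Star n r
  pairStar = record
    { center         = vertex centre
    ; leaf           = λ j → vertex (toggle (leafCoordinate (toℕ j)) centre)
    ; leaf-injective = λ {i} {j} e → toℕ-injective (swap-injective 0 a (swap-injective 1 b
                         (toggle-injective centre 2≤n (leafCoordinate-≤ i) (leafCoordinate-≤ j) e)))
    ; leaf-adj       = λ j → toggle-adjacent centre (leafCoordinate-≤ j)
    }

  pairStar-∋ᵃ : InStar (vertex (flips (a ∷ []))) pairStar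
  pairStar-∋ᵃ = inj₂ (fromℕ< 2≤r , trans (cong (λ p → vertex (toggle p centre)) coordinate)
                                     (vertex-cong (flips-cancel [] b (a ∷ []) [])))
    where
    coordinate : leafCoordinate (toℕ (fromℕ< 2≤r)) ≡ b
    coordinate rewrite toℕ-fromℕ< 2≤r | swap-other {0} {a} {1} (λ ()) (a≢1 ∘ sym) = swap-matchˡ 1 b

  pairStar-∋ᵇ : InStar (vertex (flips (b ∷ []))) pairStar
  pairStar-∋ᵇ = inj₂ (fromℕ< 1≤r , trans (cong (λ p → vertex (toggle p centre)) coordinate)
                                     (vertex-cong (flips-cancel [] a [] (b ∷ []))))
    where
    1≤r = ≤-trans (s≤s z≤n) 2≤r
    coordinate : leafCoordinate (toℕ (fromℕ< 1≤r)) ≡ a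
    coordinate rewrite toℕ-fromℕ< 1≤r | swap-matchˡ 0 a = swap-other a≢1 a≢b

  pairStar-∌ : ∀ {s} → FarFrom centre s → ¬ InStar (vertex s) pairStar
  pairStar-∌ {s} (far-centre , _) (inj₁ e) = vertex-≢ {s = centre} {s' = s} far-centre (sym e)
  pairStar-∌ {s} (_ , far-leaves) (inj₂ (j , e)) =
    vertex-≢ {s = toggle (leafCoordinate (toℕ j)) centre} {s' = s} (far-leaves _ (leafCoordinate-≤ j)) e

-- Pairing up the coordinates

∉-0∷2 : ∀ {x} → 3 ≤ x → x ∉ 0 ∷ 2 ∷ []
∉-0∷2 (s≤s (s≤s (s≤s _))) (here ())
∉-0∷2 (s≤s (s≤s (s≤s _))) (there (here ()))

module _ {n r : ℕ} (3≤n : 3 ≤ n) (2≤r : 2 ≤ r) (r≤1+n : r ≤ suc n) where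

  private
    2≤n : 2 ≤ n
    2≤n = ≤-trans (n≤1+n 2) 3≤n

    1≤n : 1 ≤ n
    1≤n = ≤-trans (n≤1+n 1) 2≤n

  data Pair : ℕ → ℕ → Set where
    pair₀₁   : Pair 0 1
    pair₂₃   : Pair 2 3
    pair-far : ∀ {a} → 4 ≤ a → suc a ≤ n → Pair a (suc a)
    pairₙ₀   : Pair n 0

  Pair-≤ˡ : ∀ {a b} → Pair a b → a ≤ n
  Pair-≤ˡ pair₀₁           = z≤n
  Pair-≤ˡ pair₂₃           = 2≤n
  Pair-≤ˡ (pair-far _ a<n) = <⇒≤ a<n
  Pair-≤ˡ pairₙ₀           = ≤-refl

  Pair-≤ʳ : ∀ {a b} → Pair a b → b ≤ n
  Pair-≤ʳ pair₀₁           = 1≤n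
  Pair-≤ʳ pair₂₃           = 3≤n
  Pair-≤ʳ (pair-far _ a<n) = a<n
  Pair-≤ʳ pairₙ₀           = z≤n

  Pair-≢ : ∀ {a b} → Pair a b → a ≢ b
  Pair-≢ pair₀₁         = λ ()
  Pair-≢ pair₂₃         = λ ()
  Pair-≢ (pair-far _ _) = <⇒≢ (n<1+n _)
  Pair-≢ pairₙ₀         = >⇒≢ 1≤n

  Pair-≢1 : ∀ {a b} → Pair a b → a ≢ 1
  Pair-≢1 pair₀₁           = λ ()
  Pair-≢1 pair₂₃           = λ ()
  Pair-≢1 (pair-far 4≤a _) = >⇒≢ (≤-trans (s≤s (s≤s z≤n)) 4≤a)
  Pair-≢1 pairₙ₀           = >⇒≢ 2≤n

  far-from-02 : ∀ {a b} p q L → flips (a ∷ b ∷ 0 ∷ 2 ∷ []) ≗ flips (p ∷ q ∷ L) →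
    p ≤ n → q ≤ n → p ≢ q → p ∉ L → q ∉ L → 3 + length L ≤ n →
    FarFrom (flips (a ∷ b ∷ [])) (flips (0 ∷ 2 ∷ []))
  far-from-02 {a} {b} p q L ≗K =
    far-by-parity p q L λ j → trans (sym (flips-++ (a ∷ b ∷ []) (0 ∷ 2 ∷ []) j)) (≗K j)

  -- Apart from the pairs {a, a+1} with a ≥ 4, a pair shares a coordinate with
  -- {0,2}; cancelling it keeps the symmetric difference small even for n ∈ {3,4}.
  Pair-far-from-02 : ∀ {a b} → Pair a b → FarFrom {n} (flips (a ∷ b ∷ [])) (flips (0 ∷ 2 ∷ []))
  Pair-far-from-02 pair₀₁ = far-from-02 1 2 [] (flips-cancel [] 0 (1 ∷ []) (2 ∷ []))
    1≤n 2≤n (λ ()) (λ ()) (λ ()) 3≤n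
  Pair-far-from-02 pair₂₃ = far-from-02 3 0 [] (flips-cancel [] 2 (3 ∷ 0 ∷ []) [])
    3≤n z≤n (λ ()) (λ ()) (λ ()) 3≤n
  Pair-far-from-02 pairₙ₀ = far-from-02 n 2 [] (flips-cancel (n ∷ []) 0 [] (2 ∷ []))
    ≤-refl 2≤n (>⇒≢ 3≤n) (λ ()) (λ ()) 3≤n
  Pair-far-from-02 (pair-far {a} 4≤a a<n) = far-from-02 a (suc a) (0 ∷ 2 ∷ []) (λ _ → refl)
    (<⇒≤ a<n) a<n (<⇒≢ (n<1+n a)) (∉-0∷2 3≤a) (∉-0∷2 (m≤n⇒m≤1+n 3≤a)) (≤-trans (s≤s 4≤a) a<n)
    where
    3≤a = ≤-trans (n≤1+n 3) 4≤a

  partner : ℕ → ℕ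
  partner k with suc (k + k) ≤? n
  ... | yes _ = suc (k + k)
  ... | no _  = 0

  partner-odd : ∀ k → suc (k + k) ≤ n → partner k ≡ suc (k + k)
  partner-odd k 2k<n with suc (k + k) ≤? n
  ... | yes _   = refl
  ... | no 2k≮n = ⊥-elim (2k≮n 2k<n)

  pairAt : ∀ k → k + k ≤ n → Pair (k + k) (partner k)
  pairAt k 2k≤n with suc (k + k) ≤? n
  pairAt zero          _    | yes _    = pair₀₁
  pairAt (suc zero)    _    | yes _    = pair₂₃
  pairAt (suc (suc k)) _    | yes 2k<n = pair-far 4≤2k 2k<n
    where 4≤2k = s≤s (s≤s (≤-trans (s≤s (s≤s z≤n)) (m≤n+m (suc (suc k)) k)))
  pairAt k             2k≤n | no 2k≮n  =
    subst (λ a → Pair a 0) (sym (≤-antisym 2k≤n (≮⇒≥ 2k≮n))) pairₙ₀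

  module StarAt {a b : ℕ} (P : Pair a b) =
    PairStar 2≤r r≤1+n 2≤n (Pair-≤ˡ P) (Pair-≤ʳ P) (Pair-≢ P) (Pair-≢1 P)

  Covers : Star n r → ℕ → Set
  Covers S t = InStar (vertex (flips (t ∷ []))) S

  pairAt-covers : ∀ t k (2k≤n : k + k ≤ n) → ⌊ t /2⌋ ≡ k → t ≤ n →
                  Covers (StarAt.pairStar (pairAt k 2k≤n)) t
  pairAt-covers t k 2k≤n refl t≤n = [ covered-even , covered-odd ]′ (even-or-odd t)
    where
    S = StarAt.pairStar (pairAt k 2k≤n)
    covered-even : t ≡ k + k → Covers S t
    covered-even even = subst (Covers S) (sym even) (StarAt.pairStar-∋ᵃ (pairAt k 2k≤n))
    covered-odd : t ≡ suc (k + k) → Covers S t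
    covered-odd odd = subst (Covers S) (trans (partner-odd k (subst (_≤ n) odd t≤n)) (sym odd))
                        (StarAt.pairStar-∋ᵇ (pairAt k 2k≤n))

  doubled-≤ : (k : Fin (suc ⌊ n /2⌋)) → toℕ k + toℕ k ≤ n
  doubled-≤ k = k≤⌊n/2⌋⇒k+k≤n n (≤-pred (toℕ<n k))

  starAt : Fin (suc ⌊ n /2⌋) → Star n r
  starAt k = StarAt.pairStar (pairAt (toℕ k) (doubled-≤ k))

  stars : List (Star n r)
  stars = List.tabulate starAt

  stars-cover : ∀ {t} → t ≤ n → Any (λ S → Covers S t) stars
  stars-cover {t} t≤n =
    tabulate⁺ {f = starAt} k (pairAt-covers t _ (doubled-≤ k) (sym (toℕ-fromℕ< _)) t≤n)
    where k = fromℕ< (s≤s (⌊n/2⌋-mono t≤n))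

  stars-avoid : ∀ {s} → (∀ {a b} → Pair a b → FarFrom {n} (flips (a ∷ b ∷ [])) s) →
                ¬ DeletedBy (vertex s) stars
  stars-avoid far deleted with tabulate⁻ {f = starAt} deleted
  ... | k , inStar = StarAt.pairStar-∌ P (far P) inStar
    where P = pairAt (toℕ k) (doubled-≤ k)

  u v : Vertex n
  u = vertex (flips [])
  v = vertex (flips (0 ∷ 2 ∷ []))

  κ-bound : κ-FQ-star-≤ n r ⌈ suc n /2⌉
  κ-bound = stars , ≤-reflexive (length-tabulate starAt) ,
    isolated⇒Disconnected {u = u} {v = v}
      (vertex-≢ {s = flips []} (flips-pair-NonConstant {q = 2} z≤n (λ ()) 2≤n))
      (stars-avoid λ P → far-from-origin (Pair-≤ˡ P) (Pair-≤ʳ P) (Pair-≢ P) 3≤n)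
      (stars-avoid Pair-far-from-02)
      (λ _ adj alive → alive (neighbour-deleted adj))
    where
    neighbour-deleted : ∀ {w} → FQAdj u w → DeletedBy w stars
    neighbour-deleted adj with adjacent⇒toggle {s = flips []} adj
    ... | t , t≤n , w≡ = subst (λ x → DeletedBy x stars) (sym w≡) (stars-cover t≤n)

lemma5p7 : (n r : ℕ) → 3 ≤ n → 2 ≤ r → r ≤ suc n →
    κ-FQ-star-≤ n r ⌈ suc n /2⌉ × κˢ-FQ-star-≤ n r ⌈ suc n /2⌉
lemma5p7 n r 3≤n 2≤r r≤1+n = κ-bound 3≤n 2≤r r≤1+n , κˢ≤κ (κ-bound 3≤n 2≤r r≤1+n)
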